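{- Let $G=(V,E)$ be a graph of order $n$ with minimum degree $\delta(G)=2$, and let $C(G)$ be its coalition number. Then: (a) If $G$ contains exactly one full vertex $f$, then $C(G)=n$ if and only if $G[V\setminus\{f\}]\in\mathcal{F}_1$. (b) If $G$ contains exactly two full vertices, then $C(G)=n$ if and only if $G\cong (K_1\cup K_{n-3})+K_2$. (c) If $G$ contains at least three full vertices, then $G\cong C_3$.
   Context: All graphs are finite and simple. A full vertex is a vertex adjacent to all other vertices. A set $D\subseteq V$ is dominating if every vertex not in $D$ has a neighbor in $D$. Two disjoint sets $A,B\subseteq V$ form a coalition if neither is dominating but $A\cup B$ is. A coalition partition of $G$ is a partition $\mathcal{P}$ of $V$ such that every member is either a dominating set of cardinality 1, or is not dominating and forms a coalition with some other member of $\mathcal{P}$. The coalition number $C(G)$ is the maximum cardinality of a coalition partition of $G$. $\cup$ denotes disjoint union and $+$ denotes the join of graphs. The family $\mathcal{F}_1$: $G$ has vertex set $\{x,y,w\}\cup P\cup Q$, where $x,y,w$ are distinct, $P,Q$ are disjoint sets disjoint from $\{x,y,w\}$, $|P\cup Q|\ge 1$, and if $Q\neq\emptyset$ then $|Q|\ge 2$. Edges: $N(x)=\{y\}$; $N(w)=P\cup Q$; each $p\in P$ is adjacent to all vertices of $(P\cup Q)\setminus\{p\}$; if $Q\ne\emptyset$, $y$ is adjacent to all vertices of $Q$, and edges (possibly none) are added between vertices of $Q$ so that $G[Q]$ has no full vertex; finally any number of edges between $y$ and vertices of $P$ may be added. -}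

module Defs where

open import Level using (0ℓ)
open import Data.Nat using (ℕ; zero; suc; _+_; _∸_; _≤_; _≡ᵇ_)
open import Data.Bool using (Bool; true; false; not; _∨_; _∧_)
open import Data.Bool.Properties using (∨-comm)
open import Data.Fin using (Fin; toℕ; splitAt; punchIn; _≟_)
open import Data.Fin.Subset using (Subset; ∣_∣)
open import Data.Vec using (tabulate)
open import Data.Sum using (_⊎_; inj₁; inj₂)
open import Data.Product using (Σ; ∃; ∃-syntax; _×_; _,_)
open import Relation.Nullary using (¬_; does; yes; no)
open import Relation.Unary using (Pred; _∈_; _∉_; _∪_)
open import Relation.Binary.PropositionalEquality using (_≡_; _≢_; refl; sym)
open import Function.Bundles using (_↔_; Inverse; _⇔_)

record Graph (n : ℕ) : Set where
  field
    adj    : Fin n → Fin n → Bool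
    adj-sym    : ∀ u v → adj u v ≡ adj v u
    adj-irrefl : ∀ v → adj v v ≡ false
open Graph public

deg : ∀ {n} → Graph n → Fin n → ℕ
deg G v = ∣ tabulate (adj G v) ∣

MinDegree : ∀ {n} → Graph n → ℕ → Set
MinDegree G d = (∀ v → d ≤ deg G v) × (∃[ v ] deg G v ≡ d)

IsFull : ∀ {n} → Graph n → Fin n → Set
IsFull G f = ∀ v → v ≢ f → adj G f v ≡ true

VSet : ℕ → Set₁
VSet n = Pred (Fin n) 0ℓ

Dominating : ∀ {n} → Graph n → VSet n → Set
Dominating G D = ∀ v → v ∉ D → ∃[ u ] (u ∈ D × adj G v u ≡ true)

Singleton : ∀ {n} → VSet n → Set
Singleton S = ∃[ v ] (∀ u → (u ∈ S → u ≡ v) × (u ≡ v → u ∈ S))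

Coalition : ∀ {n} → Graph n → VSet n → VSet n → Set
Coalition G A B = ¬ Dominating G A × ¬ Dominating G B × Dominating G (A ∪ B)

-- A partition of V into k (nonempty) parts, given by a surjection
-- c : Fin n → Fin k; the i-th part is c⁻¹(i).
part : ∀ {n k} → (Fin n → Fin k) → Fin k → VSet n
part c i v = c v ≡ i

IsCoalitionPartition : ∀ {n k} → Graph n → (Fin n → Fin k) → Set
IsCoalitionPartition G c =
  (∀ i → ∃[ v ] c v ≡ i) ×
  (∀ i → (Dominating G (part c i) × Singleton (part c i))
       ⊎ (¬ Dominating G (part c i) ×
          ∃[ j ] (j ≢ i × Coalition G (part c i) (part c j))))

HasCoalitionPartition : ∀ {n} → Graph n → ℕ → Set
HasCoalitionPartition {n} G k = Σ (Fin n → Fin k) (IsCoalitionPartition G)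

IsCoalitionNumber : ∀ {n} → Graph n → ℕ → Set
IsCoalitionNumber G k =
  HasCoalitionPartition G k × (∀ m → HasCoalitionPartition G m → m ≤ k)

record _≅_ {a b} (G : Graph a) (H : Graph b) : Set where
  field
    bij      : Fin a ↔ Fin b
    preserve : ∀ u v → adj G u v ≡ adj H (Inverse.to bij u) (Inverse.to bij v)

-- Induced subgraph G - f  (vertices relabelled by punchIn f)

delete : ∀ {m} → Graph (suc m) → Fin (suc m) → Graph m
delete G f = record
  { adj        = λ u v → adj G (punchIn f u) (punchIn f v)
  ; adj-sym    = λ u v → adj-sym G (punchIn f u) (punchIn f v)
  ; adj-irrefl = λ v → adj-irrefl G (punchIn f v)
  }

private
  dec-sym : ∀ {n} (i j : Fin n) → does (i ≟ j) ≡ does (j ≟ i)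
  dec-sym i j with i ≟ j | j ≟ i
  ... | yes _ | yes _ = refl
  ... | no _  | no _  = refl
  ... | yes p | no q  = Data.Empty.⊥-elim (q (sym p))
    where import Data.Empty
  ... | no p  | yes q = Data.Empty.⊥-elim (p (sym q))
    where import Data.Empty

  dec-diag : ∀ {n} (i : Fin n) → does (i ≟ i) ≡ true
  dec-diag i with i ≟ i
  ... | yes _ = refl
  ... | no p  = Data.Empty.⊥-elim (p refl)
    where import Data.Empty

K : (k : ℕ) → Graph k
K k = record
  { adj        = λ i j → not (does (i ≟ j))
  ; adj-sym    = λ i j → Relation.Binary.PropositionalEquality.cong not (dec-sym i j)
  ; adj-irrefl = λ i → Relation.Binary.PropositionalEquality.cong not (dec-diag i)
  }

private
  sumAdj : ∀ {a b} → Bool → Graph a → Graph b → Fin a ⊎ Fin b → Fin a ⊎ Fin b → Bool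
  sumAdj c G H (inj₁ x) (inj₁ y) = adj G x y
  sumAdj c G H (inj₂ x) (inj₂ y) = adj H x y
  sumAdj c G H (inj₁ x) (inj₂ y) = c
  sumAdj c G H (inj₂ x) (inj₁ y) = c

  sumAdj-sym : ∀ {a b} c (G : Graph a) (H : Graph b) x y → sumAdj c G H x y ≡ sumAdj c G H y x
  sumAdj-sym c G H (inj₁ x) (inj₁ y) = adj-sym G x y
  sumAdj-sym c G H (inj₂ x) (inj₂ y) = adj-sym H x y
  sumAdj-sym c G H (inj₁ x) (inj₂ y) = refl
  sumAdj-sym c G H (inj₂ x) (inj₁ y) = refl

  sumAdj-irr : ∀ {a b} c (G : Graph a) (H : Graph b) x → sumAdj c G H x x ≡ false
  sumAdj-irr c G H (inj₁ x) = adj-irrefl G x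
  sumAdj-irr c G H (inj₂ x) = adj-irrefl H x

  combine : ∀ {a b} → Bool → Graph a → Graph b → Graph (a + b)
  combine {a} c G H = record
    { adj        = λ u v → sumAdj c G H (splitAt a u) (splitAt a v)
    ; adj-sym    = λ u v → sumAdj-sym c G H (splitAt a u) (splitAt a v)
    ; adj-irrefl = λ u → sumAdj-irr c G H (splitAt a u)
    }

_∪ᴳ_ : ∀ {a b} → Graph a → Graph b → Graph (a + b)
G ∪ᴳ H = combine false G H

_+ᴳ_ : ∀ {a b} → Graph a → Graph b → Graph (a + b)
G +ᴳ H = combine true G H

infixl 6 _+ᴳ_
infixl 7 _∪ᴳ_

-- the cycle C_{m+3} on vertices 0,1,…,m+2 (i ~ i+1, and m+2 ~ 0)
private
  cyc : ∀ m → Fin (3 + m) → Fin (3 + m) → Bool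
  cyc m i j = (toℕ j ≡ᵇ suc (toℕ i)) ∨ ((toℕ i ≡ᵇ (2 + m)) ∧ (toℕ j ≡ᵇ 0))

  ≡ᵇ-suc : ∀ k → (k ≡ᵇ suc k) ≡ false
  ≡ᵇ-suc zero    = refl
  ≡ᵇ-suc (suc k) = ≡ᵇ-suc k

  cyc-irr : ∀ m k → ((k ≡ᵇ suc k) ∨ ((k ≡ᵇ (2 + m)) ∧ (k ≡ᵇ 0))) ≡ false
  cyc-irr m zero    = refl
  cyc-irr m (suc k) rewrite ≡ᵇ-suc k = Data.Bool.Properties.∧-zeroʳ (k ≡ᵇ suc m)
    where import Data.Bool.Properties

Cycle : (m : ℕ) → Graph (3 + m)
Cycle m = record
  { adj        = λ i j → cyc m i j ∨ cyc m j i
  ; adj-sym    = λ i j → ∨-comm (cyc m i j) (cyc m j i)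
  ; adj-irrefl = λ i → irr i
  }
  where
  irr : ∀ i → (cyc m i i ∨ cyc m i i) ≡ false
  irr i rewrite cyc-irr m (toℕ i) = refl

C₃ : Graph 3
C₃ = Cycle 0

InF1 : ∀ {m} → Graph m → Set₁
InF1 {m} H =
  ∃[ x ] ∃[ y ] ∃[ w ] Σ (VSet m) λ P → Σ (VSet m) λ Q →
    (x ≢ y × x ≢ w × y ≢ w) ×
    (∀ v → v ∈ P → v ∈ Q → Data.Empty.⊥) ×
    (x ∉ P ∪ Q × y ∉ P ∪ Q × w ∉ P ∪ Q) ×
    (∀ v → v ≡ x ⊎ v ≡ y ⊎ v ≡ w ⊎ v ∈ P ⊎ v ∈ Q) ×
    (∃[ v ] v ∈ P ∪ Q) ×
    ((∃[ q ] q ∈ Q) → ∃[ q₁ ] ∃[ q₂ ] (q₁ ≢ q₂ × q₁ ∈ Q × q₂ ∈ Q)) ×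
    (∀ v → (adj H x v ≡ true → v ≡ y) × (v ≡ y → adj H x v ≡ true)) ×
    (∀ v → (adj H w v ≡ true → v ∈ P ∪ Q) × (v ∈ P ∪ Q → adj H w v ≡ true)) ×
    (∀ p v → p ∈ P → v ∈ P ∪ Q → v ≢ p → adj H p v ≡ true) ×
    (∀ q → q ∈ Q → adj H y q ≡ true) ×
    (∀ q → q ∈ Q → ∃[ q′ ] (q′ ∈ Q × q′ ≢ q × adj H q q′ ≡ false))
    -- edges between y and P, and the remaining edges inside Q, are arbitrary
  where import Data.Empty

-- For a graph G on n vertices, a coalition partition with n parts consists of singletons, and
-- a singleton {u} dominates exactly when u is full. So C(G) = n iff every non-full vertex u has
-- a non-full partner v with {u, v} dominating. A vertex x of degree 2 is adjacent to every full
-- vertex, so for n ≥ 4 there are at most two full vertices, and for n = 3 the graph is C₃.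
--
-- With a unique full vertex f the partner condition on G is the same condition on G − f, where x
-- has become a vertex whose only neighbour is y. The partner of any other vertex must dominate x,
-- so it is x or y; hence every non-neighbour w of y is adjacent to all vertices outside {x, y, w},
-- and splitting those vertices into P (adjacent to all the others) and Q gives the family 𝓕₁.
--
-- With two full vertices f and g, x is adjacent to exactly f and g, the partner of every other
-- vertex is forced to be x, and so all vertices other than x are pairwise adjacent. This shape
-- determines G up to a permutation of the vertices: G ≅ (K₁ ∪ K_{n−3}) + K₂.

module Submission where

open import Defs
open import Level using (0ℓ)
open import Data.Bool using (Bool; true; false; not; _∧_; _∨_; if_then_else_)
open import Data.Bool.Properties using (∧-zeroʳ; ∧-identityʳ) renaming (_≟_ to _≟ᴮ_)
open import Data.Empty using (⊥-elim)
open import Data.Fin using (Fin; zero; suc; punchIn; punchOut; _≟_; splitAt; _↑ˡ_; _↑ʳ_)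
open import Data.Fin.Permutation using (Permutation; flip; _⟨$⟩ʳ_; _∘ₚ_; transpose)
import Data.Fin.Permutation.Components as PC
open import Data.Fin.Properties using (punchInᵢ≢i; punchIn-punchOut; punchIn-injective; punchOut-injective; injective⇒≤; any?; splitAt-↑ˡ; splitAt-↑ʳ; splitAt⁻¹-↑ˡ; splitAt⁻¹-↑ʳ; ↑ʳ-injective)
open import Data.Fin.Subset using (∣_∣)
open import Data.Fin.Subset.Properties using (∣p∣≤n)
open import Data.Nat using (ℕ; zero; suc; _+_; _∸_; _≤_; z≤n; s≤s; s≤s⁻¹)
open import Data.Nat.Properties using (≤-trans; n≮n; ≤-reflexive; +-comm)
open import Data.Product using (∃-syntax; _×_; _,_; proj₁; proj₂)
open import Data.Sum using (_⊎_; inj₁; inj₂; [_,_]′)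
import Data.Sum as Sum
open import Data.Vec using (tabulate)
open import Function using (_∘_; id; case_of_)
open import Function.Bundles using (_⇔_; mk⇔; Equivalence; Injection; Inverse)
import Function.Properties.Equivalence as ⇔
open import Function.Construct.Identity using (↔-id)
open import Function.Properties.Inverse using (↔⇒↣)
open import Relation.Binary.PropositionalEquality
open import Relation.Nullary using (¬_; yes; no; does; contradiction)
open import Relation.Nullary.Decidable using (¬?; _×-dec_; dec-true; dec-false; does-⇔)
open import Relation.Unary using (Pred; Decidable; _∪_)

true≢false : true ≢ false
true≢false ()

∣tabulate∣-punchIn : ∀ {n} (p : Fin (suc n) → Bool) a →
  ∣ tabulate p ∣ ≡ (if p a then suc else id) ∣ tabulate (p ∘ punchIn a) ∣
∣tabulate∣-punchIn p zero with p zero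
... | true  = refl
... | false = refl
∣tabulate∣-punchIn {suc n} p (suc a) with p zero | p (suc a) | ∣tabulate∣-punchIn (p ∘ suc) a
... | true  | true  | eq = cong suc eq
... | true  | false | eq = cong suc eq
... | false | _     | eq = eq

∣tabulate∣-all : ∀ {n} (p : Fin n → Bool) → (∀ t → p t ≡ true) → ∣ tabulate p ∣ ≡ n
∣tabulate∣-all {zero}  p all = refl
∣tabulate∣-all {suc n} p all rewrite all zero = cong suc (∣tabulate∣-all (p ∘ suc) (all ∘ suc))

1≤∣tabulate∣⇒true : ∀ {n} (p : Fin n → Bool) → 1 ≤ ∣ tabulate p ∣ → ∃[ t ] p t ≡ true
1≤∣tabulate∣⇒true {suc n} p 1≤ with p zero in eq
... | true  = zero , eq
... | false = let t , pt = 1≤∣tabulate∣⇒true (p ∘ suc) 1≤ in suc t , pt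

true⇒1≤∣tabulate∣ : ∀ {n} (p : Fin (suc n) → Bool) a → p a ≡ true → 1 ≤ ∣ tabulate p ∣
true⇒1≤∣tabulate∣ p a pa rewrite ∣tabulate∣-punchIn p a | pa = s≤s z≤n

punchIn-punchOut-at : ∀ {n} {A : Set} (p : Fin (suc n) → A) {a b} (a≢b : a ≢ b) →
  (p ∘ punchIn a) (punchOut a≢b) ≡ p b
punchIn-punchOut-at p a≢b = cong p (punchIn-punchOut a≢b)

distinct-trues⇒2≤∣tabulate∣ : ∀ {n} (p : Fin n → Bool) {a b} → a ≢ b →
  p a ≡ true → p b ≡ true → 2 ≤ ∣ tabulate p ∣
distinct-trues⇒2≤∣tabulate∣ {suc zero} p {zero} {zero} a≢b _ _ = ⊥-elim (a≢b refl)
distinct-trues⇒2≤∣tabulate∣ {suc (suc n)} p {a} a≢b pa pb rewrite ∣tabulate∣-punchIn p a | pa =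
  s≤s (true⇒1≤∣tabulate∣ (p ∘ punchIn a) (punchOut a≢b) (trans (punchIn-punchOut-at p a≢b) pb))

deg≤m : ∀ {m} (G : Graph (suc m)) v → deg G v ≤ m
deg≤m G v rewrite ∣tabulate∣-punchIn (adj G v) v | adj-irrefl G v =
  ∣p∣≤n (tabulate (adj G v ∘ punchIn v))

full⇒deg≡m : ∀ {m} (G : Graph (suc m)) v → IsFull G v → deg G v ≡ m
full⇒deg≡m G v full rewrite ∣tabulate∣-punchIn (adj G v) v | adj-irrefl G v =
  ∣tabulate∣-all _ (λ t → full (punchIn v t) (punchInᵢ≢i v t))

non-neighbour⇒deg<m : ∀ {m} (G : Graph (suc m)) {v t} → t ≢ v → adj G v t ≡ false →
  suc (deg G v) ≤ m
non-neighbour⇒deg<m {zero}  G {zero} {zero} t≢v _ = ⊥-elim (t≢v refl)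
non-neighbour⇒deg<m {suc m} G {v} {t} t≢v vt
  rewrite ∣tabulate∣-punchIn (adj G v) v | adj-irrefl G v
        | ∣tabulate∣-punchIn (adj G v ∘ punchIn v) (punchOut (t≢v ∘ sym))
        | punchIn-punchOut-at (adj G v) (t≢v ∘ sym) | vt
  = s≤s (∣p∣≤n (tabulate (adj G v ∘ punchIn v ∘ punchIn (punchOut (t≢v ∘ sym)))))

m≤deg⇒full : ∀ {m} (G : Graph (suc m)) v → m ≤ deg G v → IsFull G v
m≤deg⇒full {m} G v m≤deg t t≢v with adj G v t in vt
... | true  = refl
... | false = ⊥-elim (n≮n m (≤-trans (s≤s m≤deg) (non-neighbour⇒deg<m G t≢v vt)))

another-neighbour : ∀ {m} (G : Graph (suc m)) {v a} → 2 ≤ deg G v → adj G v a ≡ true →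
  ∃[ b ] (b ≢ a × adj G v b ≡ true)
another-neighbour G {v} {a} 2≤deg va rewrite ∣tabulate∣-punchIn (adj G v) a | va
  with 1≤∣tabulate∣⇒true (adj G v ∘ punchIn a) (s≤s⁻¹ 2≤deg)
... | t , vt = punchIn a t , punchInᵢ≢i a t , vt

deg≡2⇒neighbours⊆ : ∀ {m} (G : Graph (suc m)) {v a b t} → deg G v ≡ 2 → a ≢ b →
  adj G v a ≡ true → adj G v b ≡ true → adj G v t ≡ true → t ≡ a ⊎ t ≡ b
deg≡2⇒neighbours⊆ G {v} {a} {b} {t} deg≡2 a≢b va vb vt with t ≟ a | t ≟ b
... | yes t≡a | _       = inj₁ t≡a
... | no _    | yes t≡b = inj₂ t≡b
... | no t≢a  | no t≢b  = ⊥-elim (n≮n 2 (≤-trans three≤deg (≤-reflexive deg≡2)))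
  where
  three≤deg : 3 ≤ deg G v
  three≤deg rewrite ∣tabulate∣-punchIn (adj G v) a | va =
    s≤s (distinct-trues⇒2≤∣tabulate∣ (adj G v ∘ punchIn a)
           (t≢b ∘ sym ∘ punchOut-injective a≢b (t≢a ∘ sym))
           (trans (punchIn-punchOut-at (adj G v) a≢b) vb)
           (trans (punchIn-punchOut-at (adj G v) (t≢a ∘ sym)) vt))

full⇒adjacent : ∀ {n} (G : Graph n) {f v} → IsFull G f → v ≢ f → adj G v f ≡ true
full⇒adjacent G {f} {v} f-full v≢f = trans (adj-sym G v f) (f-full v v≢f)

¬full⇒adjacent : ∀ {n} (G : Graph n) {v f} → ¬ IsFull G v → IsFull G f → adj G v f ≡ true
¬full⇒adjacent G ¬full f-full = full⇒adjacent G f-full λ { refl → ¬full f-full }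

2≤order : ∀ {m} (G : Graph (suc m)) → MinDegree G 2 → 2 ≤ m
2≤order G (δ≥2 , _) = ≤-trans (δ≥2 zero) (deg≤m G zero)

order3⇒complete : (G : Graph 3) → MinDegree G 2 → ∀ v → IsFull G v
order3⇒complete G (δ≥2 , _) v = m≤deg⇒full G v (δ≥2 v)

deg≡2⇒¬full : ∀ {m} (G : Graph (suc m)) {v} → 3 ≤ m → deg G v ≡ 2 → ¬ IsFull G v
deg≡2⇒¬full G 3≤m deg≡2 full =
  n≮n 2 (≤-trans 3≤m (≤-reflexive (trans (sym (full⇒deg≡m G _ full)) deg≡2)))

K-complete : ∀ {n} v → IsFull (K n) v
K-complete v w w≢v rewrite dec-false (v ≟ w) (w≢v ∘ sym) = refl

complete-graphs-≅ : ∀ {n} (G H : Graph n) → (∀ v → IsFull G v) → (∀ v → IsFull H v) → G ≅ H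
complete-graphs-≅ G H G-complete H-complete = record { bij = ↔-id _ ; preserve = preserve }
  where
  preserve : ∀ u v → adj G u v ≡ adj H u v
  preserve u v with v ≟ u
  ... | yes refl = trans (adj-irrefl G u) (sym (adj-irrefl H u))
  ... | no v≢u   = trans (G-complete u v v≢u) (sym (H-complete u v v≢u))

C₃-complete : ∀ v → IsFull C₃ v
C₃-complete zero             zero             ne = ⊥-elim (ne refl)
C₃-complete zero             (suc zero)       _  = refl
C₃-complete zero             (suc (suc zero)) _  = refl
C₃-complete (suc zero)       zero             _  = refl
C₃-complete (suc zero)       (suc zero)       ne = ⊥-elim (ne refl)
C₃-complete (suc zero)       (suc (suc zero)) _  = refl
C₃-complete (suc (suc zero)) zero             _  = refl
C₃-complete (suc (suc zero)) (suc zero)       _  = refl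
C₃-complete (suc (suc zero)) (suc (suc zero)) ne = ⊥-elim (ne refl)

DominatingPair : ∀ {n} → Graph n → Fin n → Fin n → Set
DominatingPair G u v = ∀ t → t ≡ u ⊎ t ≡ v ⊎ adj G t u ≡ true ⊎ adj G t v ≡ true

DominatingPair-sym : ∀ {n} (G : Graph n) {u v} → DominatingPair G u v → DominatingPair G v u
DominatingPair-sym G pair t with pair t
... | inj₁ t≡u              = inj₂ (inj₁ t≡u)
... | inj₂ (inj₁ t≡v)       = inj₁ t≡v
... | inj₂ (inj₂ (inj₁ tu)) = inj₂ (inj₂ (inj₂ tu))
... | inj₂ (inj₂ (inj₂ tv)) = inj₂ (inj₂ (inj₁ tv))

SingletonCoalitionPartition : ∀ {n} → Graph n → Set
SingletonCoalitionPartition G =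
  ∀ u → IsFull G u ⊎ (¬ IsFull G u × ∃[ v ] (v ≢ u × ¬ IsFull G v × DominatingPair G u v))

HasDominatingPartners : ∀ {n} → Graph n → Set
HasDominatingPartners H = ∀ u → ∃[ v ] (v ≢ u × DominatingPair H u v)

module _ {n} (G : Graph n) where

  dominating⇒full : ∀ {S : VSet n} {u} → (∀ w → S w → w ≡ u) → Dominating G S → IsFull G u
  dominating⇒full {u = u} S⊆u dom w w≢u with dom w (w≢u ∘ S⊆u w)
  ... | s , s∈S , ws rewrite S⊆u s s∈S = trans (adj-sym G u w) ws

  full⇒dominating : ∀ {S : VSet n} {u} → S u → IsFull G u → Dominating G S
  full⇒dominating {u = u} u∈S full w w∉S = u , u∈S , trans (adj-sym G w u) (full w λ { refl → w∉S u∈S })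

  dominating⇒pair : ∀ {S T : VSet n} {u v} → (∀ w → S w → w ≡ u) → (∀ w → T w → w ≡ v) →
    Dominating G (S ∪ T) → DominatingPair G u v
  dominating⇒pair {u = u} {v} S⊆u T⊆v dom t with t ≟ u | t ≟ v
  ... | yes t≡u | _       = inj₁ t≡u
  ... | no _    | yes t≡v = inj₂ (inj₁ t≡v)
  ... | no t≢u  | no t≢v  with dom t [ t≢u ∘ S⊆u t , t≢v ∘ T⊆v t ]′
  ...   | s , inj₁ s∈S , ts rewrite S⊆u s s∈S = inj₂ (inj₂ (inj₁ ts))
  ...   | s , inj₂ s∈T , ts rewrite T⊆v s s∈T = inj₂ (inj₂ (inj₂ ts))

  pair⇒dominating : ∀ {S T : VSet n} {u v} → S u → T v → DominatingPair G u v → Dominating G (S ∪ T)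
  pair⇒dominating {u = u} {v} u∈S v∈T pair t t∉S∪T with pair t
  ... | inj₁ refl               = ⊥-elim (t∉S∪T (inj₁ u∈S))
  ... | inj₂ (inj₁ refl)        = ⊥-elim (t∉S∪T (inj₂ v∈T))
  ... | inj₂ (inj₂ (inj₁ tu))   = u , inj₁ u∈S , tu
  ... | inj₂ (inj₂ (inj₂ tv))   = v , inj₂ v∈T , tv

surjective⇒≤ : ∀ {n k} (c : Fin n → Fin k) → (∀ i → ∃[ v ] c v ≡ i) → k ≤ n
surjective⇒≤ c surj = injective⇒≤ section-injective
  where
  section-injective : ∀ {i j} → proj₁ (surj i) ≡ proj₁ (surj j) → i ≡ j
  section-injective {i} {j} eq = trans (sym (proj₂ (surj i))) (trans (cong c eq) (proj₂ (surj j)))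

-- A surjection that identified u ≠ v would stay surjective on Fin n minus u.
surjective⇒injective : ∀ {n} (c : Fin n → Fin n) → (∀ i → ∃[ v ] c v ≡ i) →
  ∀ {u v} → c u ≡ c v → u ≡ v
surjective⇒injective {suc n} c surj {u} {v} cu≡cv with u ≟ v
... | yes u≡v = u≡v
... | no u≢v  = ⊥-elim (n≮n n (surjective⇒≤ (c ∘ punchIn u) surj′))
  where
  surj′ : ∀ i → ∃[ w ] c (punchIn u w) ≡ i
  surj′ i with surj i
  ... | w , cw≡i with u ≟ w
  ...   | yes refl = punchOut u≢v , trans (cong c (punchIn-punchOut u≢v)) (trans (sym cu≡cv) cw≡i)
  ...   | no u≢w   = punchOut u≢w , trans (cong c (punchIn-punchOut u≢w)) cw≡i

coalitionNumber≡n⇔singletons : ∀ {n} (G : Graph n) →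
  IsCoalitionNumber G n ⇔ SingletonCoalitionPartition G
coalitionNumber≡n⇔singletons {n} G = mk⇔ to from
  where
  to : IsCoalitionNumber G n → SingletonCoalitionPartition G
  to ((c , surj , parts) , _) u with parts (c u) | surjective⇒injective c surj
  ... | inj₁ (dom , _) | c-injective = inj₁ (dominating⇒full G (λ _ → c-injective) dom)
  ... | inj₂ (¬dom , j , j≢cu , _ , ¬domj , dom) | c-injective with surj j
  ...   | v , refl =
    inj₂ (¬dom ∘ full⇒dominating G refl , v , j≢cu ∘ cong c , ¬domj ∘ full⇒dominating G refl ,
          dominating⇒pair G (λ _ → c-injective) (λ _ → c-injective) dom)

  singleton-parts : SingletonCoalitionPartition G → ∀ u →
    (Dominating G (part id u) × Singleton (part id u)) ⊎
    (¬ Dominating G (part id u) × ∃[ v ] (v ≢ u × Coalition G (part id u) (part id v)))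
  singleton-parts sc u with sc u
  ... | inj₁ full = inj₁ (full⇒dominating G refl full , u , λ w → id , id)
  ... | inj₂ (¬full , v , v≢u , ¬fullv , pair) =
    inj₂ (¬full ∘ dominating⇒full G (λ _ → id) , v , v≢u ,
          ¬full ∘ dominating⇒full G (λ _ → id) , ¬fullv ∘ dominating⇒full G (λ _ → id) ,
          pair⇒dominating G refl refl pair)

  from : SingletonCoalitionPartition G → IsCoalitionNumber G n
  from sc = (id , (λ i → i , refl) , singleton-parts sc) , λ _ (c , surj , _) → surjective⇒≤ c surj

HasSoleNeighbour : ∀ {n} → Graph n → Fin n → Fin n → Set
HasSoleNeighbour H x y = ∀ v → (adj H x v ≡ true → v ≡ y) × (v ≡ y → adj H x v ≡ true)

∀-true⊎∃-false : ∀ {n} {A : Pred (Fin n) 0ℓ} → Decidable A → (p : Fin n → Bool) →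
  (∀ t → A t → p t ≡ true) ⊎ ∃[ t ] (A t × p t ≡ false)
∀-true⊎∃-false {A = A} A? p with any? (λ t → A? t ×-dec (p t ≟ᴮ false))
... | yes found = inj₂ found
... | no none   = inj₁ all-true
  where
  all-true : ∀ t → A t → p t ≡ true
  all-true t At with p t in pt
  ... | true  = refl
  ... | false = ⊥-elim (none (t , At , pt))

¬full⇒non-neighbour : ∀ {n} (H : Graph n) {y} → ¬ IsFull H y → ∃[ t ] (t ≢ y × adj H y t ≡ false)
¬full⇒non-neighbour H {y} ¬full with ∀-true⊎∃-false (λ t → ¬? (t ≟ y)) (adj H y)
... | inj₁ full  = ⊥-elim (¬full full)
... | inj₂ found = found

module F1Pairs {n} (H : Graph n) {x y w : Fin n} {P Q : Pred (Fin n) 0ℓ}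
  (cover : ∀ v → v ≡ x ⊎ v ≡ y ⊎ v ≡ w ⊎ P v ⊎ Q v) (x~y : adj H x y ≡ true)
  (w~ : ∀ {v} → (P ∪ Q) v → adj H w v ≡ true)
  (P-adj : ∀ p v → P p → (P ∪ Q) v → v ≢ p → adj H p v ≡ true)
  (y~Q : ∀ q → Q q → adj H y q ≡ true) where

  private
    y~x : adj H y x ≡ true
    y~x = trans (adj-sym H y x) x~y

    ~w : ∀ {v} → (P ∪ Q) v → adj H v w ≡ true
    ~w v∈ = trans (adj-sym H _ w) (w~ v∈)

  x-w-pair : DominatingPair H x w
  x-w-pair t with cover t
  ... | inj₁ t≡x               = inj₁ t≡x
  ... | inj₂ (inj₁ refl)       = inj₂ (inj₂ (inj₁ y~x))
  ... | inj₂ (inj₂ (inj₁ t≡w)) = inj₂ (inj₁ t≡w)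
  ... | inj₂ (inj₂ (inj₂ t∈))  = inj₂ (inj₂ (inj₂ (~w t∈)))

  y-w-pair : DominatingPair H y w
  y-w-pair t with cover t
  ... | inj₁ refl              = inj₂ (inj₂ (inj₁ x~y))
  ... | inj₂ (inj₁ t≡y)        = inj₁ t≡y
  ... | inj₂ (inj₂ (inj₁ t≡w)) = inj₂ (inj₁ t≡w)
  ... | inj₂ (inj₂ (inj₂ t∈))  = inj₂ (inj₂ (inj₂ (~w t∈)))

  P-x-pair : ∀ {p} → P p → DominatingPair H p x
  P-x-pair {p} p∈P t with cover t
  ... | inj₁ t≡x                = inj₂ (inj₁ t≡x)
  ... | inj₂ (inj₁ refl)        = inj₂ (inj₂ (inj₂ y~x))
  ... | inj₂ (inj₂ (inj₁ refl)) = inj₂ (inj₂ (inj₁ (w~ (inj₁ p∈P))))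
  ... | inj₂ (inj₂ (inj₂ t∈)) with t ≟ p
  ...   | yes t≡p = inj₁ t≡p
  ...   | no t≢p  = inj₂ (inj₂ (inj₁ (trans (adj-sym H t p) (P-adj p t p∈P t∈ t≢p))))

  Q-y-pair : ∀ {q} → Q q → DominatingPair H q y
  Q-y-pair {q} q∈Q t with cover t
  ... | inj₁ refl                     = inj₂ (inj₂ (inj₂ x~y))
  ... | inj₂ (inj₁ t≡y)               = inj₂ (inj₁ t≡y)
  ... | inj₂ (inj₂ (inj₁ refl))       = inj₂ (inj₂ (inj₁ (w~ (inj₂ q∈Q))))
  ... | inj₂ (inj₂ (inj₂ (inj₂ t∈Q))) = inj₂ (inj₂ (inj₂ (trans (adj-sym H t y) (y~Q t t∈Q))))
  ... | inj₂ (inj₂ (inj₂ (inj₁ t∈P))) with t ≟ q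
  ...   | yes t≡q = inj₁ t≡q
  ...   | no t≢q  = inj₂ (inj₂ (inj₁ (P-adj t q t∈P (inj₂ q∈Q) (t≢q ∘ sym))))

F1⇒partners : ∀ {n} (H : Graph n) → InF1 H → HasDominatingPartners H
F1⇒partners H (x , y , w , P , Q , (_ , x≢w , y≢w) , _ , (x∉ , y∉ , _) , cover , _ , _ ,
               N[x] , N[w] , P-adj , y~Q , _) u = partner (cover u)
  where
  open F1Pairs H cover (proj₂ (N[x] y) refl) (proj₂ (N[w] _)) P-adj y~Q

  partner : ∀ {u} → u ≡ x ⊎ u ≡ y ⊎ u ≡ w ⊎ P u ⊎ Q u → ∃[ v ] (v ≢ u × DominatingPair H u v)
  partner (inj₁ refl)                     = w , x≢w ∘ sym , x-w-pair
  partner (inj₂ (inj₁ refl))              = w , y≢w ∘ sym , y-w-pair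
  partner (inj₂ (inj₂ (inj₁ refl)))       = x , x≢w , DominatingPair-sym H x-w-pair
  partner (inj₂ (inj₂ (inj₂ (inj₁ u∈P)))) = x , (λ { refl → x∉ (inj₁ u∈P) }) , P-x-pair u∈P
  partner (inj₂ (inj₂ (inj₂ (inj₂ u∈Q)))) = y , (λ { refl → y∉ (inj₂ u∈Q) }) , Q-y-pair u∈Q

module _ {n} (H : Graph n) {x y : Fin n}
         (N[x] : HasSoleNeighbour H x y)
         (partners : HasDominatingPartners H) where

  private
    x~y : adj H x y ≡ true
    x~y = proj₂ (N[x] y) refl

  partner-of-non-neighbour : ∀ {u s} → u ≢ x → u ≢ y → DominatingPair H u s → s ≡ x ⊎ s ≡ y
  partner-of-non-neighbour {u} u≢x u≢y pair with pair x
  ... | inj₁ x≡u               = ⊥-elim (u≢x (sym x≡u))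
  ... | inj₂ (inj₁ x≡s)        = inj₁ (sym x≡s)
  ... | inj₂ (inj₂ (inj₁ x~u)) = ⊥-elim (u≢y (proj₁ (N[x] u) x~u))
  ... | inj₂ (inj₂ (inj₂ x~s)) = inj₂ (proj₁ (N[x] _) x~s)

  -- If t were not adjacent to u, then t would have to be dominated by u's partner, x or y.
  non-neighbour-of-y⇒adjacent : ∀ {t} → t ≢ y → adj H y t ≡ false →
    ∀ {u} → u ≢ x → u ≢ y → u ≢ t → adj H t u ≡ true
  non-neighbour-of-y⇒adjacent {t} t≢y y≁t {u} u≢x u≢y u≢t with adj H t u in t~u
  ... | true  = refl
  ... | false with partners u
  ... | s , _ , pair with partner-of-non-neighbour u≢x u≢y pair | pair t
  ... | _         | inj₁ t≡u                = ⊥-elim (u≢t (sym t≡u))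
  ... | _         | inj₂ (inj₂ (inj₁ t~u′)) = ⊥-elim (true≢false (trans (sym t~u′) t~u))
  ... | inj₁ refl | inj₂ (inj₁ refl)        = ⊥-elim (true≢false (trans (sym x~y) (trans (adj-sym H s y) y≁t)))
  ... | inj₁ refl | inj₂ (inj₂ (inj₂ t~x))  = ⊥-elim (t≢y (proj₁ (N[x] t) (trans (adj-sym H s t) t~x)))
  ... | inj₂ refl | inj₂ (inj₁ t≡y)         = ⊥-elim (t≢y t≡y)
  ... | inj₂ refl | inj₂ (inj₂ (inj₂ t~y))  = ⊥-elim (true≢false (trans (sym t~y) (trans (adj-sym H t s) y≁t)))

  module _ (no-full : ∀ u → ¬ IsFull H u) (has-neighbour : ∀ u → ∃[ v ] adj H u v ≡ true) where

    private
      non-neighbour-of-y = ¬full⇒non-neighbour H (no-full y)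
      w   = proj₁ non-neighbour-of-y
      w≢y = proj₁ (proj₂ non-neighbour-of-y)
      y≁w = proj₂ (proj₂ non-neighbour-of-y)

      x≢y : x ≢ y
      x≢y refl = true≢false (trans (sym x~y) (adj-irrefl H x))

      x≢w : x ≢ w
      x≢w refl = true≢false (trans (sym x~y) (trans (adj-sym H x y) y≁w))

      Outside : Pred (Fin n) 0ℓ
      Outside v = v ≢ x × v ≢ y × v ≢ w

      Outside? : Decidable Outside
      Outside? v = ¬? (v ≟ x) ×-dec ¬? (v ≟ y) ×-dec ¬? (v ≟ w)

      P Q : Pred (Fin n) 0ℓ
      P v = Outside v × (∀ u → Outside u × u ≢ v → adj H v u ≡ true)
      Q v = Outside v × ∃[ u ] ((Outside u × u ≢ v) × adj H v u ≡ false)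

      P∪Q⇒Outside : ∀ {v} → (P ∪ Q) v → Outside v
      P∪Q⇒Outside (inj₁ (out , _)) = out
      P∪Q⇒Outside (inj₂ (out , _)) = out

      classify : ∀ {v} → Outside v → (P ∪ Q) v
      classify {v} out with ∀-true⊎∃-false (λ u → Outside? u ×-dec ¬? (u ≟ v)) (adj H v)
      ... | inj₁ adjacent = inj₁ (out , adjacent)
      ... | inj₂ missing  = inj₂ (out , missing)

      Q-non-neighbour : ∀ {q} → Q q → ∃[ u ] (Q u × u ≢ q × adj H q u ≡ false)
      Q-non-neighbour {q} (q-out , u , (u-out , u≢q) , q≁u) with classify u-out
      ... | inj₁ (_ , u-adj) =
        ⊥-elim (true≢false (trans (sym (u-adj q (q-out , u≢q ∘ sym))) (trans (adj-sym H u q) q≁u)))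
      ... | inj₂ u∈Q = u , u∈Q , u≢q , q≁u

      w~ : ∀ {v} → Outside v → adj H w v ≡ true
      w~ (v≢x , v≢y , v≢w) = non-neighbour-of-y⇒adjacent w≢y y≁w v≢x v≢y v≢w

      w~⇒Outside : ∀ {v} → adj H w v ≡ true → Outside v
      w~⇒Outside w~v =
        (λ { refl → w≢y (proj₁ (N[x] w) (trans (adj-sym H x w) w~v)) }) ,
        (λ { refl → true≢false (trans (sym w~v) (trans (adj-sym H w y) y≁w)) }) ,
        (λ { refl → true≢false (trans (sym w~v) (adj-irrefl H w)) })

      y~Q : ∀ {q} → Q q → adj H y q ≡ true
      y~Q {q} ((q≢x , q≢y , _) , u , ((u≢x , u≢y , _) , u≢q) , q≁u) with adj H y q in y~q
      ... | true  = refl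
      ... | false = ⊥-elim (true≢false
                      (trans (sym (non-neighbour-of-y⇒adjacent q≢y y~q u≢x u≢y u≢q)) q≁u))

      cover : ∀ v → v ≡ x ⊎ v ≡ y ⊎ v ≡ w ⊎ P v ⊎ Q v
      cover v with v ≟ x | v ≟ y | v ≟ w
      ... | yes v≡x | _       | _       = inj₁ v≡x
      ... | no _    | yes v≡y | _       = inj₂ (inj₁ v≡y)
      ... | no _    | no _    | yes v≡w = inj₂ (inj₂ (inj₁ v≡w))
      ... | no v≢x  | no v≢y  | no v≢w  = inj₂ (inj₂ (inj₂ (classify (v≢x , v≢y , v≢w))))

    partners⇒F1 : InF1 H
    partners⇒F1 =
      x , y , w , P , Q , (x≢y , x≢w , w≢y ∘ sym) ,
      (λ { v (_ , v-adj) (_ , u , u-out , v≁u) → true≢false (trans (sym (v-adj u u-out)) v≁u) }) ,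
      ((λ x∈ → proj₁ (P∪Q⇒Outside x∈) refl) , (λ y∈ → proj₁ (proj₂ (P∪Q⇒Outside y∈)) refl) ,
       (λ w∈ → proj₂ (proj₂ (P∪Q⇒Outside w∈)) refl)) ,
      cover ,
      (let v , w~v = has-neighbour w in v , classify (w~⇒Outside w~v)) ,
      (λ { (q , q∈Q) → let u , u∈Q , u≢q , _ = Q-non-neighbour q∈Q in q , u , u≢q ∘ sym , q∈Q , u∈Q }) ,
      N[x] ,
      (λ v → classify ∘ w~⇒Outside , w~ ∘ P∪Q⇒Outside) ,
      (λ p v (_ , p-adj) v∈ v≢p → p-adj v (P∪Q⇒Outside v∈ , v≢p)) ,
      (λ q → y~Q) ,
      (λ q → Q-non-neighbour)

data PunchInView {m} (f : Fin (suc m)) : Fin (suc m) → Set where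
  at       : PunchInView f f
  punched  : ∀ t → PunchInView f (punchIn f t)

punchInView : ∀ {m} (f t : Fin (suc m)) → PunchInView f t
punchInView f t with f ≟ t
... | yes refl = at
... | no f≢t   = subst (PunchInView f) (punchIn-punchOut f≢t) (punched (punchOut f≢t))

module _ {m} (G : Graph (suc m)) {f} (f-full : IsFull G f) where

  full-in-delete⇒full : ∀ {u} → IsFull (delete G f) u → IsFull G (punchIn f u)
  full-in-delete⇒full {u} full t t≢ with punchInView f t
  ... | at         = full⇒adjacent G f-full (punchInᵢ≢i f u)
  ... | punched t′ = full t′ (t≢ ∘ cong (punchIn f))

  pair-in-delete⇒pair : ∀ {u v} → DominatingPair (delete G f) u v →
    DominatingPair G (punchIn f u) (punchIn f v)
  pair-in-delete⇒pair {u} pair t with punchInView f t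
  ... | at         = inj₂ (inj₂ (inj₁ (f-full _ (punchInᵢ≢i f u))))
  ... | punched t′ = Sum.map (cong (punchIn f)) (Sum.map₁ (cong (punchIn f))) (pair t′)

  pair⇒pair-in-delete : ∀ {u v} → DominatingPair G (punchIn f u) (punchIn f v) →
    DominatingPair (delete G f) u v
  pair⇒pair-in-delete {u} {v} pair t =
    Sum.map (punchIn-injective f t u) (Sum.map₁ (punchIn-injective f t v)) (pair (punchIn f t))

  neighbour-in-delete : ∀ {u} → 2 ≤ deg G (punchIn f u) → ∃[ v ] adj (delete G f) u v ≡ true
  neighbour-in-delete {u} 2≤deg
    with another-neighbour G 2≤deg (full⇒adjacent G f-full (punchInᵢ≢i f u))
  ... | v , v≢f , u~v with punchInView f v
  ...   | at         = ⊥-elim (v≢f refl)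
  ...   | punched v′ = v′ , u~v

  sole-neighbour-in-delete : ∀ {x} → deg G (punchIn f x) ≡ 2 →
    ∃[ y ] HasSoleNeighbour (delete G f) x y
  sole-neighbour-in-delete {x} deg≡2 = sole (another-neighbour G (≤-reflexive (sym deg≡2)) x~f)
    where
    x~f : adj G (punchIn f x) f ≡ true
    x~f = full⇒adjacent G f-full (punchInᵢ≢i f x)

    sole : ∃[ y ] (y ≢ f × adj G (punchIn f x) y ≡ true) → ∃[ y ] HasSoleNeighbour (delete G f) x y
    sole (y , y≢f , x~y) with punchInView f y
    ... | at         = ⊥-elim (y≢f refl)
    ... | punched y′ = y′ , λ v → only-y′ v , λ { refl → x~y }
      where
      only-y′ : ∀ v → adj G (punchIn f x) (punchIn f v) ≡ true → v ≡ y′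
      only-y′ v x~v with deg≡2⇒neighbours⊆ G deg≡2 (y≢f ∘ sym) x~f x~y x~v
      ... | inj₁ v≡f  = ⊥-elim (punchInᵢ≢i f v v≡f)
      ... | inj₂ v≡y′ = punchIn-injective f v y′ v≡y′

  module _ (f-unique : ∀ g → IsFull G g → g ≡ f) where

    ¬full-punchIn : ∀ u → ¬ IsFull G (punchIn f u)
    ¬full-punchIn u full = punchInᵢ≢i f u (f-unique _ full)

    singletons⇔partners-in-delete :
      SingletonCoalitionPartition G ⇔ HasDominatingPartners (delete G f)
    singletons⇔partners-in-delete = mk⇔ to from
      where
      to : SingletonCoalitionPartition G → HasDominatingPartners (delete G f)
      to sc u with sc (punchIn f u)
      ... | inj₁ full = ⊥-elim (¬full-punchIn u full)
      ... | inj₂ (_ , v , v≢u , ¬full-v , pair) with punchInView f v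
      ...   | at         = ⊥-elim (¬full-v f-full)
      ...   | punched v′ = v′ , v≢u ∘ cong (punchIn f) , pair⇒pair-in-delete pair

      from : HasDominatingPartners (delete G f) → SingletonCoalitionPartition G
      from partners u with punchInView f u
      ... | at         = inj₁ f-full
      ... | punched u′ =
        let v′ , v′≢u′ , pair = partners u′ in
        inj₂ (¬full-punchIn u′ , punchIn f v′ , v′≢u′ ∘ punchIn-injective f v′ u′ ,
              ¬full-punchIn v′ , pair-in-delete⇒pair pair)

    ¬full-in-delete : ∀ u → ¬ IsFull (delete G f) u
    ¬full-in-delete u = ¬full-punchIn u ∘ full-in-delete⇒full

coalitionNumber≡n⇔F1 : ∀ {m} (G : Graph (suc m)) → 3 ≤ m → MinDegree G 2 →
  ∀ {f} → IsFull G f → (∀ g → IsFull G g → g ≡ f) →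
  IsCoalitionNumber G (suc m) ⇔ InF1 (delete G f)
coalitionNumber≡n⇔F1 G 3≤m (δ≥2 , x , deg-x≡2) {f} f-full f-unique with punchInView f x
... | at = ⊥-elim (deg≡2⇒¬full G 3≤m deg-x≡2 f-full)
... | punched x′ =
  let y′ , N[x′] = sole-neighbour-in-delete G f-full deg-x≡2 in
  ⇔.trans (coalitionNumber≡n⇔singletons G)
    (⇔.trans (singletons⇔partners-in-delete G f-full f-unique)
      (mk⇔ (λ partners → partners⇒F1 H N[x′] partners (¬full-in-delete G f-full f-unique)
                            (λ u → neighbour-in-delete G f-full (δ≥2 (punchIn f u))))
           (F1⇒partners H)))
  where H = delete G f

transpose-source : ∀ {n} (i j : Fin n) → PC.transpose i j i ≡ j
transpose-source i j rewrite dec-true (i ≟ i) refl = refl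

transpose-fixes : ∀ {n} {i j k : Fin n} → k ≢ i → k ≢ j → PC.transpose i j k ≡ k
transpose-fixes {i = i} {j} {k} k≢i k≢j rewrite dec-false (k ≟ i) k≢i | dec-false (k ≟ j) k≢j = refl

⟨$⟩ʳ-injective : ∀ {m n} (π : Permutation m n) {x y} → π ⟨$⟩ʳ x ≡ π ⟨$⟩ʳ y → x ≡ y
⟨$⟩ʳ-injective π = Injection.injective (↔⇒↣ π)

triple-permutation : ∀ {n} {a f g a′ f′ g′ : Fin n} → a ≢ f → a ≢ g → f ≢ g →
  a′ ≢ f′ → a′ ≢ g′ → f′ ≢ g′ →
  ∃[ π ] (π ⟨$⟩ʳ a ≡ a′ × π ⟨$⟩ʳ f ≡ f′ × π ⟨$⟩ʳ g ≡ g′)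
triple-permutation {a = a} {f} {g} {a′} {f′} {g′} a≢f a≢g f≢g a′≢f′ a′≢g′ f′≢g′ =
  σ₁ ∘ₚ σ₂ ∘ₚ σ₃ , σ₃-fixes a a′≢σ₂g a′≢g′ σ₂a , σ₃-fixes f f′≢σ₂g f′≢g′ σ₂f , transpose-source σ₂g g′
  where
  σ₁ = transpose a a′
  σ₂ = transpose (σ₁ ⟨$⟩ʳ f) f′
  σ₂g = (σ₁ ∘ₚ σ₂) ⟨$⟩ʳ g
  σ₃ = transpose σ₂g g′

  a′≢σ₁f : a′ ≢ σ₁ ⟨$⟩ʳ f
  a′≢σ₁f eq = a≢f (⟨$⟩ʳ-injective σ₁ (trans (transpose-source a a′) eq))

  σ₂a : (σ₁ ∘ₚ σ₂) ⟨$⟩ʳ a ≡ a′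
  σ₂a rewrite transpose-source a a′ = transpose-fixes a′≢σ₁f a′≢f′

  σ₂f : (σ₁ ∘ₚ σ₂) ⟨$⟩ʳ f ≡ f′
  σ₂f = transpose-source (σ₁ ⟨$⟩ʳ f) f′

  a′≢σ₂g : a′ ≢ σ₂g
  a′≢σ₂g eq = a≢g (⟨$⟩ʳ-injective (σ₁ ∘ₚ σ₂) (trans σ₂a eq))

  f′≢σ₂g : f′ ≢ σ₂g
  f′≢σ₂g eq = f≢g (⟨$⟩ʳ-injective (σ₁ ∘ₚ σ₂) (trans σ₂f eq))

  σ₃-fixes : ∀ x {y} → y ≢ σ₂g → y ≢ g′ → (σ₁ ∘ₚ σ₂) ⟨$⟩ʳ x ≡ y → (σ₁ ∘ₚ σ₂ ∘ₚ σ₃) ⟨$⟩ʳ x ≡ y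
  σ₃-fixes x y≢σ₂g y≢g′ refl = transpose-fixes y≢σ₂g y≢g′

-- In (K₁ ∪ K_{n-3}) + K₂, a is the vertex of K₁ and f, g are those of K₂.
record ApexPairShape {n} (G : Graph n) (a f g : Fin n) : Set where
  field
    a≢f           : a ≢ f
    a≢g           : a ≢ g
    f≢g           : f ≢ g
    f-full        : IsFull G f
    g-full        : IsFull G g
    N[a]⊆         : ∀ v → adj G a v ≡ true → v ≡ f ⊎ v ≡ g
    core-adjacent : ∀ u v → u ≢ a → u ≢ f → u ≢ g → v ≢ a → v ≢ u → adj G u v ≡ true

module Shape = ApexPairShape

data Role : Set where
  solo core apex : Role

role : ∀ {n} → Fin n → Fin n → Fin n → Fin n → Role
role a f g u = if does (u ≟ a) then solo else if does (u ≟ f) ∨ does (u ≟ g) then apex else core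

joined : Role → Role → Bool
joined apex _    = true
joined _    apex = true
joined core core = true
joined _    _    = false

module _ {n} {G : Graph n} {a f g : Fin n} (shape : ApexPairShape G a f g) where
  open ApexPairShape shape

  a≁ : ∀ {v} → v ≢ f → v ≢ g → adj G a v ≡ false
  a≁ {v} v≢f v≢g with adj G a v in a~v
  ... | false = refl
  ... | true  = ⊥-elim ([ v≢f , v≢g ]′ (N[a]⊆ v a~v))

  shape⇒adj≢ : ∀ {u v} → u ≢ v → adj G u v ≡ joined (role a f g u) (role a f g v)
  shape⇒adj≢ {u} {v} u≢v with u ≟ a
  ... | yes refl with v ≟ a | v ≟ f | v ≟ g
  ...   | yes v≡a | _        | _        = ⊥-elim (u≢v (sym v≡a))
  ...   | no _    | yes refl | _        = full⇒adjacent G f-full a≢f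
  ...   | no _    | no _     | yes refl = full⇒adjacent G g-full a≢g
  ...   | no _    | no v≢f   | no v≢g   = a≁ v≢f v≢g
  shape⇒adj≢ {u} {v} u≢v | no u≢a with u ≟ f | u ≟ g
  ... | yes refl | _        = f-full v (u≢v ∘ sym)
  ... | no _     | yes refl = g-full v (u≢v ∘ sym)
  ... | no u≢f   | no u≢g   with v ≟ a | v ≟ f | v ≟ g
  ...   | yes refl | _        | _        = trans (adj-sym G u a) (a≁ u≢f u≢g)
  ...   | no _     | yes refl | _        = full⇒adjacent G f-full u≢f
  ...   | no _     | no _     | yes refl = full⇒adjacent G g-full u≢g
  ...   | no v≢a   | no _     | no _     = core-adjacent u v u≢a u≢f u≢g v≢a (u≢v ∘ sym)

  shape⇒adj : ∀ u v → adj G u v ≡ joined (role a f g u) (role a f g v) ∧ not (does (u ≟ v))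
  shape⇒adj u v with u ≟ v
  ... | yes refl = trans (adj-irrefl G u) (sym (∧-zeroʳ _))
  ... | no u≢v   = trans (shape⇒adj≢ u≢v) (sym (∧-identityʳ _))

  core-a-pair : ∀ {u} → u ≢ a → u ≢ f → u ≢ g → DominatingPair G u a
  core-a-pair {u} u≢a u≢f u≢g t with t ≟ u | t ≟ a | t ≟ f | t ≟ g
  ... | yes t≡u | _       | _        | _        = inj₁ t≡u
  ... | no _    | yes t≡a | _        | _        = inj₂ (inj₁ t≡a)
  ... | no _    | no _    | yes refl | _        = inj₂ (inj₂ (inj₂ (f-full a a≢f)))
  ... | no _    | no _    | no _     | yes refl = inj₂ (inj₂ (inj₂ (g-full a a≢g)))
  ... | no t≢u  | no t≢a  | no t≢f   | no t≢g   =
    inj₂ (inj₂ (inj₁ (core-adjacent t u t≢a t≢f t≢g u≢a (t≢u ∘ sym))))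

  core-¬full : ∀ {u} → u ≢ a → u ≢ f → u ≢ g → ¬ IsFull G u
  core-¬full u≢a u≢f u≢g u-full =
    true≢false (trans (sym (u-full a (u≢a ∘ sym))) (trans (adj-sym G _ a) (a≁ u≢f u≢g)))

  a-¬full : ∀ {u} → u ≢ a → u ≢ f → u ≢ g → ¬ IsFull G a
  a-¬full u≢a u≢f u≢g a-full = true≢false (trans (sym (a-full _ u≢a)) (a≁ u≢f u≢g))

  shape⇒singletons : ∀ {b} → b ≢ a → b ≢ f → b ≢ g → SingletonCoalitionPartition G
  shape⇒singletons {b} b≢a b≢f b≢g u with u ≟ a | u ≟ f | u ≟ g
  ... | yes refl | _        | _        =
    inj₂ (a-¬full b≢a b≢f b≢g , b , b≢a , core-¬full b≢a b≢f b≢g ,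
          DominatingPair-sym G (core-a-pair b≢a b≢f b≢g))
  ... | no _     | yes refl | _        = inj₁ f-full
  ... | no _     | no _     | yes refl = inj₁ g-full
  ... | no u≢a   | no u≢f   | no u≢g   =
    inj₂ (core-¬full u≢a u≢f u≢g , a , u≢a ∘ sym , a-¬full u≢a u≢f u≢g , core-a-pair u≢a u≢f u≢g)

shapes⇒≅ : ∀ {n₁ n₂} → n₁ ≡ n₂ → {G₁ : Graph n₁} {G₂ : Graph n₂}
  {a₁ f₁ g₁ : Fin n₁} {a₂ f₂ g₂ : Fin n₂} →
  ApexPairShape G₁ a₁ f₁ g₁ → ApexPairShape G₂ a₂ f₂ g₂ → G₁ ≅ G₂
shapes⇒≅ refl {G₁} {G₂} {a₁} {f₁} {g₁} shape₁ shape₂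
  with triple-permutation (Shape.a≢f shape₁) (Shape.a≢g shape₁) (Shape.f≢g shape₁)
                          (Shape.a≢f shape₂) (Shape.a≢g shape₂) (Shape.f≢g shape₂)
... | π , refl , refl , refl = record { bij = π ; preserve = preserve }
  where
  π≟ : ∀ u v → does (π ⟨$⟩ʳ u ≟ π ⟨$⟩ʳ v) ≡ does (u ≟ v)
  π≟ u v = does-⇔ (mk⇔ (⟨$⟩ʳ-injective π) (cong (π ⟨$⟩ʳ_))) (π ⟨$⟩ʳ u ≟ π ⟨$⟩ʳ v) (u ≟ v)

  π-role : ∀ u → role (π ⟨$⟩ʳ a₁) (π ⟨$⟩ʳ f₁) (π ⟨$⟩ʳ g₁) (π ⟨$⟩ʳ u) ≡ role a₁ f₁ g₁ u
  π-role u rewrite π≟ u a₁ | π≟ u f₁ | π≟ u g₁ = refl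

  preserve : ∀ u v → adj G₁ u v ≡ adj G₂ (π ⟨$⟩ʳ u) (π ⟨$⟩ʳ v)
  preserve u v rewrite shape⇒adj shape₁ u v | shape⇒adj shape₂ (π ⟨$⟩ʳ u) (π ⟨$⟩ʳ v)
                     | π-role u | π-role v | π≟ u v = refl

module _ {n₁ n₂} {G : Graph n₁} {H : Graph n₂} (iso : G ≅ H) where
  open _≅_ iso
  open Inverse bij using (to; from; strictlyInverseˡ; strictlyInverseʳ)

  private
    to≡⇒≡from : ∀ {u p} → to u ≡ p → u ≡ from p
    to≡⇒≡from {u} eq = trans (sym (strictlyInverseʳ u)) (cong from eq)

    adj-from : ∀ p v → adj G (from p) v ≡ adj H p (to v)
    adj-from p v = trans (preserve (from p) v) (cong (λ z → adj H z (to v)) (strictlyInverseˡ p))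

  ≅-≢ : ∀ {p q} → p ≢ q → from p ≢ from q
  ≅-≢ p≢q = p≢q ∘ ⟨$⟩ʳ-injective (flip bij)

  ≅-shape : ∀ {a f g} → ApexPairShape H a f g → ApexPairShape G (from a) (from f) (from g)
  ≅-shape {a} {f} {g} shape = record
    { a≢f           = ≅-≢ a≢f
    ; a≢g           = ≅-≢ a≢g
    ; f≢g           = ≅-≢ f≢g
    ; f-full        = λ v v≢ → trans (adj-from f v) (f-full (to v) (v≢ ∘ to≡⇒≡from))
    ; g-full        = λ v v≢ → trans (adj-from g v) (g-full (to v) (v≢ ∘ to≡⇒≡from))
    ; N[a]⊆         = λ v a~v → Sum.map to≡⇒≡from to≡⇒≡from (N[a]⊆ (to v) (trans (sym (adj-from a v)) a~v))
    ; core-adjacent = λ u v u≢a u≢f u≢g v≢a v≢u →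
        trans (preserve u v) (core-adjacent (to u) (to v) (u≢a ∘ to≡⇒≡from) (u≢f ∘ to≡⇒≡from)
          (u≢g ∘ to≡⇒≡from) (v≢a ∘ to≡⇒≡from) (v≢u ∘ ⟨$⟩ʳ-injective bij))
    }
    where open ApexPairShape shape

data SplitView (a b : ℕ) : Fin (a + b) → Set where
  left  : ∀ i → SplitView a b (i ↑ˡ b)
  right : ∀ j → SplitView a b (a ↑ʳ j)

splitView : ∀ a {b} (u : Fin (a + b)) → SplitView a b u
splitView a {b} u with splitAt a u in eq
... | inj₁ i = subst (SplitView a b) (splitAt⁻¹-↑ˡ eq) (left i)
... | inj₂ j = subst (SplitView a b) (splitAt⁻¹-↑ʳ eq) (right j)

module _ {a b} (G : Graph a) (H : Graph b) where

  +ᴳ-left : ∀ i j → adj (G +ᴳ H) (i ↑ˡ b) (j ↑ˡ b) ≡ adj G i j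
  +ᴳ-left i j rewrite splitAt-↑ˡ a i b | splitAt-↑ˡ a j b = refl

  +ᴳ-right : ∀ i j → adj (G +ᴳ H) (a ↑ʳ i) (a ↑ʳ j) ≡ adj H i j
  +ᴳ-right i j rewrite splitAt-↑ʳ a b i | splitAt-↑ʳ a b j = refl

  +ᴳ-across : ∀ i j → adj (G +ᴳ H) (i ↑ˡ b) (a ↑ʳ j) ≡ true
  +ᴳ-across i j rewrite splitAt-↑ˡ a i b | splitAt-↑ʳ a b j = refl

  +ᴳ-full-right : ∀ {j} → IsFull H j → IsFull (G +ᴳ H) (a ↑ʳ j)
  +ᴳ-full-right {j} j-full v v≢ with splitView a v
  ... | left i   = trans (adj-sym (G +ᴳ H) (a ↑ʳ j) (i ↑ˡ b)) (+ᴳ-across i j)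
  ... | right j′ = trans (+ᴳ-right j j′) (j-full j′ (v≢ ∘ cong (a ↑ʳ_)))

module _ (k : ℕ) where

  private
    T : Graph ((1 + suc k) + 2)
    T = (K 1 ∪ᴳ K (suc k)) +ᴳ K 2

    f g : Fin ((1 + suc k) + 2)
    f = (2 + k) ↑ʳ zero
    g = (2 + k) ↑ʳ suc zero

    solo-isolated : ∀ i → adj (K 1 ∪ᴳ K (suc k)) zero i ≡ false
    solo-isolated zero    = refl
    solo-isolated (suc i) = refl

    N[a]⊆ : ∀ v → adj T zero v ≡ true → v ≡ f ⊎ v ≡ g
    N[a]⊆ v a~v with splitView (2 + k) v
    ... | left i           = ⊥-elim (true≢false (trans (sym a~v) (trans (+ᴳ-left _ _ zero i) (solo-isolated i))))
    ... | right zero       = inj₁ refl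
    ... | right (suc zero) = inj₂ refl

    core-adjacent : ∀ u v → u ≢ zero → u ≢ f → u ≢ g → v ≢ zero → v ≢ u → adj T u v ≡ true
    core-adjacent u v u≢a u≢f u≢g v≢a v≢u with splitView (2 + k) u | splitView (2 + k) v
    ... | left zero    | _                = ⊥-elim (u≢a refl)
    ... | right zero   | _                = ⊥-elim (u≢f refl)
    ... | right (suc zero) | _            = ⊥-elim (u≢g refl)
    ... | left (suc i) | left zero        = ⊥-elim (v≢a refl)
    ... | left (suc i) | left (suc j)     =
      trans (+ᴳ-left _ _ (suc i) (suc j)) (K-complete i j (v≢u ∘ cong (λ l → suc l ↑ˡ 2)))
    ... | left (suc i) | right j          = +ᴳ-across _ _ (suc i) j

  apex-pair-shape : ApexPairShape T zero f g
  apex-pair-shape = record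
    { a≢f           = λ ()
    ; a≢g           = λ ()
    ; f≢g           = λ f≡g → case ↑ʳ-injective (2 + k) zero (suc zero) f≡g of λ ()
    ; f-full        = +ᴳ-full-right (K 1 ∪ᴳ K (suc k)) (K 2) (K-complete zero)
    ; g-full        = +ᴳ-full-right (K 1 ∪ᴳ K (suc k)) (K 2) (K-complete (suc zero))
    ; N[a]⊆         = N[a]⊆
    ; core-adjacent = core-adjacent
    }

module _ {m} (G : Graph (suc m)) {x f g} (deg-x≡2 : deg G x ≡ 2) (x-¬full : ¬ IsFull G x)
         (f≢g : f ≢ g) (f-full : IsFull G f) (g-full : IsFull G g)
         (only-f-g : ∀ h → IsFull G h → h ≡ f ⊎ h ≡ g) where

  private
    N[x]⊆ : ∀ v → adj G x v ≡ true → v ≡ f ⊎ v ≡ g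
    N[x]⊆ v = deg≡2⇒neighbours⊆ G deg-x≡2 f≢g (¬full⇒adjacent G x-¬full f-full)
                (¬full⇒adjacent G x-¬full g-full)

    ¬full⇒∉ : ∀ {u} → ¬ IsFull G u → ¬ (u ≡ f ⊎ u ≡ g)
    ¬full⇒∉ ¬full (inj₁ refl) = ¬full f-full
    ¬full⇒∉ ¬full (inj₂ refl) = ¬full g-full

  -- The partner of a vertex outside {x, f, g} must dominate x, which forces it to be x itself.
  singletons⇒shape : SingletonCoalitionPartition G → ApexPairShape G x f g
  singletons⇒shape singletons = record
    { a≢f = ¬full⇒∉ x-¬full ∘ inj₁ ; a≢g = ¬full⇒∉ x-¬full ∘ inj₂ ; f≢g = f≢g
    ; f-full = f-full ; g-full = g-full ; N[a]⊆ = N[x]⊆ ; core-adjacent = core-adjacent }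
    where

    core-adjacent : ∀ u v → u ≢ x → u ≢ f → u ≢ g → v ≢ x → v ≢ u → adj G u v ≡ true
    core-adjacent u v u≢x u≢f u≢g v≢x v≢u with singletons u
    ... | inj₁ u-full = ⊥-elim ([ u≢f , u≢g ]′ (only-f-g u u-full))
    ... | inj₂ (_ , s , _ , s-¬full , pair) = adjacent (partner≡x (pair x))
      where
      partner≡x : x ≡ u ⊎ x ≡ s ⊎ adj G x u ≡ true ⊎ adj G x s ≡ true → s ≡ x
      partner≡x (inj₁ x≡u)              = ⊥-elim (u≢x (sym x≡u))
      partner≡x (inj₂ (inj₁ x≡s))       = sym x≡s
      partner≡x (inj₂ (inj₂ (inj₁ x~u))) = ⊥-elim ([ u≢f , u≢g ]′ (N[x]⊆ u x~u))
      partner≡x (inj₂ (inj₂ (inj₂ x~s))) = ⊥-elim (¬full⇒∉ s-¬full (N[x]⊆ s x~s))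

      adjacent : s ≡ x → adj G u v ≡ true
      adjacent refl with pair v
      ... | inj₁ v≡u               = ⊥-elim (v≢u v≡u)
      ... | inj₂ (inj₁ v≡x)        = ⊥-elim (v≢x v≡x)
      ... | inj₂ (inj₂ (inj₁ v~u)) = trans (adj-sym G u v) v~u
      ... | inj₂ (inj₂ (inj₂ v~x)) with N[x]⊆ v (trans (adj-sym G x v) v~x)
      ...   | inj₁ refl = full⇒adjacent G f-full u≢f
      ...   | inj₂ refl = full⇒adjacent G g-full u≢g

coalitionNumber≡n⇔≅ : ∀ k (G : Graph (4 + k)) → MinDegree G 2 → ∀ {f g} → f ≢ g →
  IsFull G f → IsFull G g → (∀ h → IsFull G h → h ≡ f ⊎ h ≡ g) →
  IsCoalitionNumber G (4 + k) ⇔ G ≅ ((K 1 ∪ᴳ K (suc k)) +ᴳ K 2)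
coalitionNumber≡n⇔≅ k G (_ , x , deg-x≡2) f≢g f-full g-full only-f-g = mk⇔
  (λ cn → shapes⇒≅ order≡ (singletons⇒shape G deg-x≡2 x-¬full f≢g f-full g-full only-f-g
                              (Equivalence.to (coalitionNumber≡n⇔singletons G) cn))
                      (apex-pair-shape k))
  (λ iso → Equivalence.from (coalitionNumber≡n⇔singletons G)
             (shape⇒singletons (≅-shape iso (apex-pair-shape k))
               (≅-≢ iso {suc zero} λ ()) (≅-≢ iso {suc zero} λ ()) (≅-≢ iso {suc zero} λ ())))
  where
  x-¬full = deg≡2⇒¬full G (s≤s (s≤s (s≤s z≤n))) deg-x≡2

  order≡ : 4 + k ≡ (1 + suc k) + 2
  order≡ = cong (2 +_) (+-comm 2 k)

one-full-vertex : ∀ m (G : Graph (suc m)) → MinDegree G 2 → (f : Fin (suc m)) → IsFull G f →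
  (∀ g → IsFull G g → g ≡ f) → IsCoalitionNumber G (suc m) ⇔ InF1 (delete G f)
one-full-vertex 0 G δ≥2 _ _ _ = contradiction (2≤order G δ≥2) λ ()
one-full-vertex 1 G δ≥2 _ _ _ = contradiction (2≤order G δ≥2) λ { (s≤s ()) }
one-full-vertex 2 G δ≥2 f _ f-unique =
  ⊥-elim (punchInᵢ≢i f zero (f-unique _ (order3⇒complete G δ≥2 _)))
one-full-vertex (suc (suc (suc k))) G δ≥2 f = coalitionNumber≡n⇔F1 G (s≤s (s≤s (s≤s z≤n))) δ≥2

third-vertex : ∀ {n} {f g : Fin (3 + n)} → f ≢ g → ∃[ h ] (h ≢ f × h ≢ g)
third-vertex {f = f} {g} f≢g =
  punchIn f (punchIn g′ zero) , punchInᵢ≢i f _ ,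
  λ h≡g → punchInᵢ≢i g′ zero (punchIn-injective f _ _ (trans h≡g (sym (punchIn-punchOut f≢g))))
  where g′ = punchOut f≢g

two-full-vertices : ∀ m (G : Graph (suc m)) → MinDegree G 2 → (f g : Fin (suc m)) → f ≢ g →
  IsFull G f → IsFull G g → (∀ h → IsFull G h → h ≡ f ⊎ h ≡ g) →
  IsCoalitionNumber G (suc m) ⇔ G ≅ ((K 1 ∪ᴳ K (suc m ∸ 3)) +ᴳ K 2)
two-full-vertices 0 G δ≥2 _ _ _ _ _ _ = contradiction (2≤order G δ≥2) λ ()
two-full-vertices 1 G δ≥2 _ _ _ _ _ _ = contradiction (2≤order G δ≥2) λ { (s≤s ()) }
two-full-vertices 2 G δ≥2 f g f≢g _ _ only-f-g with third-vertex f≢g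
... | h , h≢f , h≢g = ⊥-elim ([ h≢f , h≢g ]′ (only-f-g h (order3⇒complete G δ≥2 h)))
two-full-vertices (suc (suc (suc k))) G δ≥2 f g = coalitionNumber≡n⇔≅ k G δ≥2

three-full⇒≅C₃ : ∀ m (G : Graph (suc m)) → MinDegree G 2 → (f g h : Fin (suc m)) →
  f ≢ g → f ≢ h → g ≢ h → IsFull G f → IsFull G g → IsFull G h → G ≅ C₃
three-full⇒≅C₃ 0 G δ≥2 _ _ _ _ _ _ _ _ _ = contradiction (2≤order G δ≥2) λ ()
three-full⇒≅C₃ 1 G δ≥2 _ _ _ _ _ _ _ _ _ = contradiction (2≤order G δ≥2) λ { (s≤s ()) }
three-full⇒≅C₃ 2 G δ≥2 _ _ _ _ _ _ _ _ _ = complete-graphs-≅ G C₃ (order3⇒complete G δ≥2) C₃-complete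
three-full⇒≅C₃ (suc (suc (suc k))) G (_ , x , deg-x≡2) f g h f≢g f≢h g≢h f-full g-full h-full =
  ⊥-elim ([ f≢h ∘ sym , g≢h ∘ sym ]′ (deg≡2⇒neighbours⊆ G deg-x≡2 f≢g (x~ f-full) (x~ g-full) (x~ h-full)))
  where
  x~ : ∀ {v} → IsFull G v → adj G x v ≡ true
  x~ = ¬full⇒adjacent G (deg≡2⇒¬full G (s≤s (s≤s (s≤s z≤n))) deg-x≡2)

theorem6 : ∀ (m : ℕ) (G : Graph (suc m)) → MinDegree G 2 →
  ((f : Fin (suc m)) → IsFull G f → (∀ g → IsFull G g → g ≡ f) →
     (IsCoalitionNumber G (suc m) ⇔ InF1 (delete G f)))
  ×
  ((f g : Fin (suc m)) → f ≢ g → IsFull G f → IsFull G g →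
     (∀ h → IsFull G h → h ≡ f ⊎ h ≡ g) →
     (IsCoalitionNumber G (suc m) ⇔ G ≅ ((K 1 ∪ᴳ K (suc m ∸ 3)) +ᴳ K 2)))
  ×
  ((f g h : Fin (suc m)) → f ≢ g → f ≢ h → g ≢ h →
     IsFull G f → IsFull G g → IsFull G h → G ≅ C₃)
theorem6 m G δ≥2 = one-full-vertex m G δ≥2 , two-full-vertices m G δ≥2 , three-full⇒≅C₃ m G δ≥2
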